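{- Let $\sigma$ be a permutation avoiding $213$ and $231$, with factor decomposition $\sigma=F(m)F(m-1)\cdots F(1)$, and let $2\le i\le m$. If $F(i)$ is an ascent factor (respectively a descent factor), then the maximal (respectively minimal) element of the suffix $F(i)F(i-1)\cdots F(1)$ is the leftmost element of $F(i-1)$.
   Context: For a permutation $\sigma$ of length $k$ and $1\le i<k$, $\sigma[i]$ is an ascent element if $\sigma[i]<\sigma[i+1]$ and a descent element if $\sigma[i]>\sigma[i+1]$. The factor decomposition of $\sigma$: partition the positions $1,\dots,k-1$ into maximal intervals of consecutive positions all of whose elements are ascent elements or all descent elements, and append position $k$ to the last interval; the resulting consecutive blocks of $\sigma$ are the factors, labelled from right to left as $F(1)$ (rightmost), $F(2)$, \dots, $F(m)$ (leftmost), so $\sigma=F(m)\cdots F(1)$. A factor is an ascent (resp. descent) factor if its elements other than $\sigma[k]$ are ascent (resp. descent) elements. For example $\sigma=123984765$ decomposes as $F(4)=123$, $F(3)=98$, $F(2)=4$, $F(1)=765$. -}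

module Defs where

open import Data.Nat using (ℕ; zero; suc; _<_; _≤_; _<ᵇ_; _∸_)
open import Data.Bool using (Bool; true; false; not; _xor_)
open import Data.List using (List; []; _∷_; length; drop; concat; lookup; applyUpTo)
open import Data.List.Membership.Propositional using (_∈_)
open import Data.List.Relation.Unary.All using (All)
open import Data.List.Relation.Binary.Permutation.Propositional using (_↭_)
open import Data.Fin using (Fin; toℕ) renaming (_<_ to _<ᶠ_)
open import Data.Product using (_×_)
open import Relation.Binary.PropositionalEquality using (_≡_)
open import Relation.Nullary using (¬_)

IsPerm : List ℕ → Set
IsPerm σ = σ ↭ applyUpTo suc (length σ)

Avoids213 : List ℕ → Set
Avoids213 σ = (i j l : Fin (length σ)) → i <ᶠ j → j <ᶠ l →
  ¬ (lookup σ j < lookup σ i × lookup σ i < lookup σ l)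

Avoids231 : List ℕ → Set
Avoids231 σ = (i j l : Fin (length σ)) → i <ᶠ j → j <ᶠ l →
  ¬ (lookup σ l < lookup σ i × lookup σ i < lookup σ j)

sameKind : ℕ → ℕ → ℕ → Bool
sameKind x y z = not ((x <ᵇ y) xor (y <ᵇ z))

private
  joinF : ℕ → Bool → List (List ℕ) → List (List ℕ)
  joinF x true  (b ∷ bs) = (x ∷ b) ∷ bs
  joinF x true  []       = (x ∷ []) ∷ []
  joinF x false bs       = (x ∷ []) ∷ bs

-- The factor decomposition of σ, listed from LEFT to RIGHT: [F(m), ..., F(1)].
-- Maximal runs of consecutive positions 1..k-1 of the same kind (ascent/descent),
-- with position k appended to the last run.
factors : List ℕ → List (List ℕ)
factors []                = []
factors (x ∷ [])          = (x ∷ []) ∷ []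
factors (x ∷ y ∷ [])      = (x ∷ y ∷ []) ∷ []
factors (x ∷ y ∷ z ∷ r)   = joinF x (sameKind x y z) (factors (y ∷ z ∷ r))

numFactors : List ℕ → ℕ
numFactors σ = length (factors σ)

headOr : {A : Set} → A → List A → A
headOr d []      = d
headOr d (x ∷ _) = x

F : List ℕ → ℕ → List ℕ
F σ i = headOr [] (drop (numFactors σ ∸ i) (factors σ))

Suffix : List ℕ → ℕ → List ℕ
Suffix σ i = concat (drop (numFactors σ ∸ i) (factors σ))

-- Positions are taken inside the suffix F(i)...F(1) of σ, whose consecutive positions
-- are consecutive positions of σ; the first length(F(i)) positions are those of F(i);
-- the last position of the suffix is position k of σ.
AscentFactor : List ℕ → ℕ → Set
AscentFactor σ i = (p q : Fin (length (Suffix σ i))) →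
  toℕ p < length (F σ i) → toℕ q ≡ suc (toℕ p) →
  lookup (Suffix σ i) p < lookup (Suffix σ i) q

DescentFactor : List ℕ → ℕ → Set
DescentFactor σ i = (p q : Fin (length (Suffix σ i))) →
  toℕ p < length (F σ i) → toℕ q ≡ suc (toℕ p) →
  lookup (Suffix σ i) q < lookup (Suffix σ i) p

IsMaxOf : ℕ → List ℕ → Set
IsMaxOf x xs = x ∈ xs × All (λ y → y ≤ x) xs

IsMinOf : ℕ → List ℕ → Set
IsMinOf x xs = x ∈ xs × All (λ y → x ≤ y) xs

module Submission where

open import Defs
open import Data.Nat using (ℕ; _≤_; _∸_)
open import Data.List using (List; head)
open import Data.Maybe using (just)
open import Data.Product using (_×_; ∃-syntax)
open import Relation.Binary.PropositionalEquality using (_≡_)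

open import Data.Nat using (zero; suc; _+_; _<_; _>_; _<ᵇ_; z≤n; s≤s; z<s; s<s)
open import Data.Nat.Properties
  using (<-trans; <⇒≤; <⇒≢; <⇒≯; ≤-refl; ≮⇒≥; ≤∧≢⇒<; m∸n≤m; suc-injective; _<?_)
open import Data.Bool using (true; false)
open import Data.Bool.Properties using (xor-same)
open import Data.List using ([]; _∷_; _++_; length; drop; concat; lookup)
open import Data.List.Properties using (∷-injectiveʳ)
open import Data.List.Membership.Propositional using (_∈_)
open import Data.List.Membership.Propositional.Properties using (∈-++⁺ʳ)
open import Data.List.Relation.Unary.All as All using (All; []; _∷_)
open import Data.List.Relation.Unary.All.Properties using (++⁺; ∷ʳ⁻)
open import Data.List.Relation.Unary.AllPairs using (_∷_)
open import Data.List.Relation.Unary.Any as Any using (here; there)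
open import Data.List.Relation.Unary.Any.Properties using (lookup-index)
open import Data.List.Relation.Unary.Unique.Propositional using (Unique)
open import Data.List.Relation.Unary.Unique.Propositional.Properties using (applyUpTo⁺₁)
open import Data.List.Relation.Binary.Permutation.Propositional using (↭⇒↭ₛ; ↭-sym)
open import Data.List.Relation.Binary.Permutation.Setoid.Properties using (Unique-resp-↭)
open import Function using (_∘_)
open import Data.Fin as Fin using (Fin; toℕ)
open import Data.Product using (_,_; proj₂; ∃₂)
open import Data.Sum using (_⊎_; inj₁; inj₂)
open import Data.Unit using (⊤; tt)
open import Data.Empty using (⊥)
open import Relation.Nullary using (¬_; yes; no; contradiction)
open import Relation.Nullary.Decidable using (dec-true; dec-false)
open import Relation.Binary.Definitions using (Transitive)
open import Relation.Binary.PropositionalEquality using (refl; sym; trans; cong; subst; setoid; _≢_)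

-- Avoiding 213 and 231 means every entry is either below or above all entries to its
-- right.  At the junction of F(i) and F(i-1) the kind of step changes: if F(i) ascends
-- into h, the leftmost entry of F(i-1), then h cannot be below everything after it
-- (the next step would again be an ascent), so h is above everything after it, and the
-- ascending run F(i) lies below h as well.  Descent factors are symmetric.

IsPerm⇒Unique : ∀ σ → IsPerm σ → Unique σ
IsPerm⇒Unique σ σ↭1…k = Unique-resp-↭ (setoid ℕ) (↭⇒↭ₛ (↭-sym σ↭1…k))
  (applyUpTo⁺₁ suc (length σ) (λ i<j _ → <⇒≢ i<j ∘ suc-injective))

SuffixExtremal : List ℕ → Set
SuffixExtremal []      = ⊤
SuffixExtremal (x ∷ r) = (All (x <_) r ⊎ All (_< x) r) × SuffixExtremal r

SuffixExtremal-++⁻ʳ : ∀ xs {ys} → SuffixExtremal (xs ++ ys) → SuffixExtremal ys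
SuffixExtremal-++⁻ʳ []       e = e
SuffixExtremal-++⁻ʳ (x ∷ xs) e = SuffixExtremal-++⁻ʳ xs (proj₂ e)

Avoids213-tail : ∀ {x r} → Avoids213 (x ∷ r) → Avoids213 r
Avoids213-tail avoid i j l i<j j<l = avoid (Fin.suc i) (Fin.suc j) (Fin.suc l) (s<s i<j) (s<s j<l)

Avoids231-tail : ∀ {x r} → Avoids231 (x ∷ r) → Avoids231 r
Avoids231-tail avoid i j l i<j j<l = avoid (Fin.suc i) (Fin.suc j) (Fin.suc l) (s<s i<j) (s<s j<l)

avoids⇒SuffixExtremal : ∀ σ → Unique σ → Avoids213 σ → Avoids231 σ → SuffixExtremal σ
avoids⇒SuffixExtremal []          _          _    _    = tt
avoids⇒SuffixExtremal (x ∷ [])    _          _    _    = inj₁ [] , tt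
avoids⇒SuffixExtremal (x ∷ y ∷ r) (x∉ ∷ uniq) a213 a231 =
  extremal , avoids⇒SuffixExtremal (y ∷ r) uniq (Avoids213-tail a213) (Avoids231-tail a231)
  where
  ≢x : ∀ {z} → z ∈ y ∷ r → z ≢ x
  ≢x z∈ z≡x = All.lookup x∉ z∈ (sym z≡x)

  extremal : All (x <_) (y ∷ r) ⊎ All (_< x) (y ∷ r)
  extremal with x <? y
  ... | yes x<y = inj₁ (All.tabulate above)
    where
    above : ∀ {z} → z ∈ y ∷ r → x < z
    above (here refl) = x<y
    above {z} (there z∈r) = ≤∧≢⇒< (≮⇒≥ z≮x) (≢x (there z∈r) ∘ sym)
      where
      z≮x : ¬ z < x
      z≮x z<x = a231 Fin.zero (Fin.suc Fin.zero) (Fin.suc (Fin.suc (Any.index z∈r))) z<s (s<s z<s)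
        (subst (_< x) (lookup-index z∈r) z<x , x<y)
  ... | no x≮y = inj₂ (All.tabulate below)
    where
    y<x : y < x
    y<x = ≤∧≢⇒< (≮⇒≥ x≮y) (≢x (here refl))

    below : ∀ {z} → z ∈ y ∷ r → z < x
    below (here refl) = y<x
    below {z} (there z∈r) = ≤∧≢⇒< (≮⇒≥ x≮z) (≢x (there z∈r))
      where
      x≮z : ¬ x < z
      x≮z x<z = a213 Fin.zero (Fin.suc Fin.zero) (Fin.suc (Fin.suc (Any.index z∈r))) z<s (s<s z<s)
        (y<x , subst (x <_) (lookup-index z∈r) x<z)

data KindChange : List ℕ → ℕ → List ℕ → Set where
  kindChange : ∀ {A a h z t} → sameKind a h z ≡ false → KindChange (A ++ a ∷ []) h (z ∷ t)

kindChange-∷ : ∀ {x A h t} → KindChange A h t → KindChange (x ∷ A) h t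
kindChange-∷ {x} (kindChange {A} change) = kindChange {A = x ∷ A} change

-- The ⊥ clause records that factors are nonempty.
FactorBoundaries : List (List ℕ) → Set
FactorBoundaries []                  = ⊤
FactorBoundaries (A ∷ [])            = ⊤
FactorBoundaries (A ∷ [] ∷ fs)       = ⊥
FactorBoundaries (A ∷ (h ∷ B) ∷ fs)  = KindChange A h (B ++ concat fs) × FactorBoundaries ((h ∷ B) ∷ fs)

FactorBoundaries-∷ : ∀ {x A} fs → FactorBoundaries (A ∷ fs) → FactorBoundaries ((x ∷ A) ∷ fs)
FactorBoundaries-∷ []            _            = tt
FactorBoundaries-∷ ((h ∷ B) ∷ fs) (change , bs) = kindChange-∷ change , bs

FactorBoundaries-tail : ∀ {A} fs → FactorBoundaries (A ∷ fs) → FactorBoundaries fs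
FactorBoundaries-tail []             _       = tt
FactorBoundaries-tail ((h ∷ B) ∷ fs) (_ , bs) = bs

factors-∷∷ : ∀ y z r → ∃₂ λ B fs → factors (y ∷ z ∷ r) ≡ (y ∷ B) ∷ fs
factors-∷∷ y z []      = z ∷ [] , [] , refl
factors-∷∷ y z (w ∷ r) with factors (z ∷ w ∷ r) | factors-∷∷ z w r
... | _ | B , fs , refl with sameKind y z w
...   | true  = z ∷ B , fs , refl
...   | false = [] , (z ∷ B) ∷ fs , refl

concat-factors : ∀ σ → concat (factors σ) ≡ σ
concat-factors []            = refl
concat-factors (x ∷ [])      = refl
concat-factors (x ∷ y ∷ [])  = refl
concat-factors (x ∷ y ∷ z ∷ r)
  with factors (y ∷ z ∷ r) | factors-∷∷ y z r | concat-factors (y ∷ z ∷ r)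
... | _ | B , fs , refl | ih with sameKind x y z
...   | true  = cong (x ∷_) ih
...   | false = cong (x ∷_) ih

factors-boundaries : ∀ σ → FactorBoundaries (factors σ)
factors-boundaries []            = tt
factors-boundaries (x ∷ [])      = tt
factors-boundaries (x ∷ y ∷ [])  = tt
factors-boundaries (x ∷ y ∷ z ∷ r)
  with factors (y ∷ z ∷ r) | factors-∷∷ y z r
     | factors-boundaries (y ∷ z ∷ r) | concat-factors (y ∷ z ∷ r)
... | _ | B , fs , refl | bs | concat≡ with sameKind x y z in kind
...   | true  = FactorBoundaries-∷ fs bs
...   | false = subst (KindChange (x ∷ []) y) (sym (∷-injectiveʳ concat≡)) (kindChange {A = []} kind) , bs

LinkedPrefix : (ℕ → ℕ → Set) → ℕ → List ℕ → Set
LinkedPrefix R n xs = (p q : Fin (length xs)) → toℕ p < n → toℕ q ≡ suc (toℕ p) →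
  R (lookup xs p) (lookup xs q)

LinkedPrefix-tail : ∀ {R n} x xs → LinkedPrefix R (suc n) (x ∷ xs) → LinkedPrefix R n xs
LinkedPrefix-tail _ _ linked p q p<n q≡1+p = linked (Fin.suc p) (Fin.suc q) (s<s p<n) (cong suc q≡1+p)

LinkedPrefix⇒All : ∀ {R} → Transitive R → ∀ A h t →
  LinkedPrefix R (length A) (A ++ h ∷ t) → All (λ y → R y h) A
LinkedPrefix⇒All trans-R []          h t linked = []
LinkedPrefix⇒All trans-R (a ∷ [])    h t linked = linked Fin.zero (Fin.suc Fin.zero) z<s refl ∷ []
LinkedPrefix⇒All {R} trans-R (a ∷ b ∷ A) h t linked
  with LinkedPrefix⇒All trans-R (b ∷ A) h t (LinkedPrefix-tail {R} a (b ∷ A ++ h ∷ t) linked)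
... | b≺h ∷ rest = trans-R (linked Fin.zero (Fin.suc Fin.zero) z<s refl) b≺h ∷ b≺h ∷ rest

sameStep⇒sameKind : ∀ a h z → (a <ᵇ h) ≡ (h <ᵇ z) → sameKind a h z ≡ true
sameStep⇒sameKind a h z same rewrite same | xor-same (h <ᵇ z) = refl

-- does (m <? n) reduces to m <ᵇ n, so dec-true/dec-false evaluate the steps of sameKind.
ascents⇒sameKind : ∀ {a h z} → a < h → h < z → sameKind a h z ≡ true
ascents⇒sameKind {a} {h} {z} a<h h<z =
  sameStep⇒sameKind a h z (trans (dec-true (a <? h) a<h) (sym (dec-true (h <? z) h<z)))

descents⇒sameKind : ∀ {a h z} → h < a → z < h → sameKind a h z ≡ true
descents⇒sameKind {a} {h} {z} h<a z<h =
  sameStep⇒sameKind a h z (trans (dec-false (a <? h) (<⇒≯ h<a)) (sym (dec-false (h <? z) (<⇒≯ z<h))))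

kindChange⇒¬ascents : ∀ {a h z} → sameKind a h z ≡ false → a < h → ¬ h < z
kindChange⇒¬ascents change a<h h<z = contradiction (trans (sym (ascents⇒sameKind a<h h<z)) change) λ ()

kindChange⇒¬descents : ∀ {a h z} → sameKind a h z ≡ false → h < a → ¬ z < h
kindChange⇒¬descents change h<a z<h = contradiction (trans (sym (descents⇒sameKind h<a z<h)) change) λ ()

IsMaxOf-middle : ∀ {h} A t → All (_< h) A → All (_< h) t → IsMaxOf h (A ++ h ∷ t)
IsMaxOf-middle A t A<h t<h = ∈-++⁺ʳ A (here refl) , ++⁺ (All.map <⇒≤ A<h) (≤-refl ∷ All.map <⇒≤ t<h)

IsMinOf-middle : ∀ {h} A t → All (h <_) A → All (h <_) t → IsMinOf h (A ++ h ∷ t)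
IsMinOf-middle A t h<A h<t = ∈-++⁺ʳ A (here refl) , ++⁺ (All.map <⇒≤ h<A) (≤-refl ∷ All.map <⇒≤ h<t)

ascent-junction-max : ∀ {A h t} → KindChange A h t → SuffixExtremal (h ∷ t) →
  LinkedPrefix _<_ (length A) (A ++ h ∷ t) → IsMaxOf h (A ++ h ∷ t)
ascent-junction-max {A} {h} {t} (kindChange change) (h-extremal , _) ascending =
  IsMaxOf-middle A t A<h (t<h h-extremal)
  where
  A<h : All (_< h) A
  A<h = LinkedPrefix⇒All {_<_} <-trans A h t ascending

  t<h : All (h <_) t ⊎ All (_< h) t → All (_< h) t
  t<h (inj₁ (h<z ∷ _)) = contradiction h<z (kindChange⇒¬ascents change (proj₂ (∷ʳ⁻ A<h)))
  t<h (inj₂ t<h)       = t<h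

descent-junction-min : ∀ {A h t} → KindChange A h t → SuffixExtremal (h ∷ t) →
  LinkedPrefix _>_ (length A) (A ++ h ∷ t) → IsMinOf h (A ++ h ∷ t)
descent-junction-min {A} {h} {t} (kindChange change) (h-extremal , _) descending =
  IsMinOf-middle A t h<A (h<t h-extremal)
  where
  h<A : All (h <_) A
  h<A = LinkedPrefix⇒All {_>_} (λ y<x z<y → <-trans z<y y<x) A h t descending

  h<t : All (h <_) t ⊎ All (_< h) t → All (h <_) t
  h<t (inj₁ h<t)       = h<t
  h<t (inj₂ (z<h ∷ _)) = contradiction z<h (kindChange⇒¬descents change (proj₂ (∷ʳ⁻ h<A)))

HeadOfNextIsExtremum : List ℕ → List ℕ → List ℕ → Set
HeadOfNextIsExtremum A B s =
  (LinkedPrefix _<_ (length A) s → ∃[ x ] (head B ≡ just x × IsMaxOf x s))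
  × (LinkedPrefix _>_ (length A) s → ∃[ x ] (head B ≡ just x × IsMinOf x s))

junction-extremum : ∀ A B fs → FactorBoundaries (A ∷ B ∷ fs) → SuffixExtremal (concat (A ∷ B ∷ fs)) →
  HeadOfNextIsExtremum A B (concat (A ∷ B ∷ fs))
junction-extremum A (h ∷ B) fs (change , _) extremal =
  (λ ascending → h , refl , ascent-junction-max change h-extremal ascending)
  , (λ descending → h , refl , descent-junction-min change h-extremal descending)
  where
  h-extremal : SuffixExtremal (h ∷ B ++ concat fs)
  h-extremal = SuffixExtremal-++⁻ʳ A extremal

drop-junction-extremum : ∀ j fs → FactorBoundaries fs → SuffixExtremal (concat fs) → 2 + j ≤ length fs →
  HeadOfNextIsExtremum (headOr [] (drop j fs)) (headOr [] (drop (suc j) fs)) (concat (drop j fs))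
drop-junction-extremum zero    (A ∷ B ∷ fs) bs extremal _ = junction-extremum A B fs bs extremal
drop-junction-extremum zero    (A ∷ [])     _  _        (s≤s ())
drop-junction-extremum (suc j) (A ∷ fs)     bs extremal (s≤s 2+j≤) =
  drop-junction-extremum j fs (FactorBoundaries-tail fs bs) (SuffixExtremal-++⁻ʳ A extremal) 2+j≤

m∸[n∸1]≡1+m∸n : ∀ m n → 1 ≤ n → n ≤ m → m ∸ (n ∸ 1) ≡ suc (m ∸ n)
m∸[n∸1]≡1+m∸n (suc m) (suc zero)    _ _         = refl
m∸[n∸1]≡1+m∸n (suc m) (suc (suc n)) _ (s≤s n≤m) = m∸[n∸1]≡1+m∸n m (suc n) (s≤s z≤n) n≤m

2+m∸n≤m : ∀ m n → 2 ≤ n → n ≤ m → 2 + (m ∸ n) ≤ m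
2+m∸n≤m (suc (suc m)) (suc (suc n)) _         _         = s≤s (s≤s (m∸n≤m m n))
2+m∸n≤m (suc zero)    (suc (suc n)) _         (s≤s ())
2+m∸n≤m (suc m)       (suc zero)    (s≤s ())  _

corollary3 : (σ : List ℕ) → IsPerm σ → Avoids213 σ → Avoids231 σ →
    (i : ℕ) → 2 ≤ i → i ≤ numFactors σ →
    (AscentFactor σ i → ∃[ x ] (head (F σ (i ∸ 1)) ≡ just x × IsMaxOf x (Suffix σ i)))
    × (DescentFactor σ i → ∃[ x ] (head (F σ (i ∸ 1)) ≡ just x × IsMinOf x (Suffix σ i)))
corollary3 σ perm a213 a231 i 2≤i i≤m
  rewrite m∸[n∸1]≡1+m∸n (numFactors σ) i (<⇒≤ 2≤i) i≤m =
  drop-junction-extremum (numFactors σ ∸ i) (factors σ) (factors-boundaries σ) extremal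
    (2+m∸n≤m (numFactors σ) i 2≤i i≤m)
  where
  extremal : SuffixExtremal (concat (factors σ))
  extremal = subst SuffixExtremal (sym (concat-factors σ))
    (avoids⇒SuffixExtremal σ (IsPerm⇒Unique σ perm) a213 a231)
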